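{- Let $AQ_3=\mathrm{Cay}(\mathbb{Z}_2^3,S)$ with $S=\{100,010,001,011,111\}$. Then $\mathrm{Aut}(AQ_3)\cong (D_8\times D_8)\rtimes C_2$.
   Context: For a group $H$ and a subset $S\subseteq H$ not containing the identity and closed under inverses, $\mathrm{Cay}(H,S)$ is the undirected graph with vertex set $H$ in which $h$ and $sh$ are adjacent for all $h\in H$, $s\in S$. Vectors of $\mathbb{Z}_2^3$ are written as bit strings. $D_8$ is the dihedral group of order 8, $C_2$ the cyclic group of order 2; the group $(D_8\times D_8)\rtimes C_2$ is the one in which $C_2$ acts by swapping the two factors (the automorphism group of two disjoint 4-cycles). -}

module Defs where

open import Data.Bool using (Bool; true; false; _xor_; if_then_else_)
open import Data.Vec using (Vec; []; _∷_; zipWith)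
import Data.Fin
open import Data.Fin using (Fin; toℕ)
open import Data.Nat using (ℕ; _+_; _∸_)
open import Data.Nat.DivMod using (_mod_)
open import Data.Product using (_×_; _,_)
open import Relation.Binary.PropositionalEquality using (_≡_; refl; sym; trans; cong; cong₂)
open import Algebra.Bundles.Raw using (RawGroup)
open import Level using (0ℓ)

-- ℤ₂³ : bit strings of length 3 (leftmost bit = first entry)
V : Set
V = Vec Bool 3

_⊕_ : V → V → V
_⊕_ = zipWith _xor_

inS : V → Bool
inS (true  ∷ false ∷ false ∷ []) = true
inS (false ∷ true  ∷ false ∷ []) = true
inS (false ∷ false ∷ true  ∷ []) = true
inS (false ∷ true  ∷ true  ∷ []) = true
inS (true  ∷ true  ∷ true  ∷ []) = true
inS _ = false

-- h ~ s h for s ∈ S; in ℤ₂³: u ~ v iff u ⊕ v ∈ S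
adj : V → V → Bool
adj u v = inS (u ⊕ v)

record Automorphism : Set where
  field
    fun     : V → V
    inv     : V → V
    inv-l   : ∀ v → inv (fun v) ≡ v
    inv-r   : ∀ v → fun (inv v) ≡ v
    pres    : ∀ u v → adj (fun u) (fun v) ≡ adj u v

open Automorphism public

idAut : Automorphism
idAut = record { fun = λ v → v ; inv = λ v → v ; inv-l = λ _ → refl ; inv-r = λ _ → refl ; pres = λ _ _ → refl }

_∘Aut_ : Automorphism → Automorphism → Automorphism
f ∘Aut g = record
  { fun   = λ v → fun f (fun g v)
  ; inv   = λ v → inv g (inv f v)
  ; inv-l = λ v → trans (cong (inv g) (inv-l f (fun g v))) (inv-l g v)
  ; inv-r = λ v → trans (cong (fun f) (inv-r g (inv f v))) (inv-r f v)
  ; pres  = λ u v → trans (pres f (fun g u) (fun g v)) (pres g u v)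
  }

invAut : Automorphism → Automorphism
invAut f = record
  { fun   = inv f
  ; inv   = fun f
  ; inv-l = inv-r f
  ; inv-r = inv-l f
  ; pres  = λ u v → trans (sym (pres f (inv f u) (inv f v)))
                          (cong₂ adj (inv-r f u) (inv-r f v))
  }

_≈Aut_ : Automorphism → Automorphism → Set
f ≈Aut g = ∀ v → fun f v ≡ fun g v

AutAQ3 : RawGroup 0ℓ 0ℓ
AutAQ3 = record
  { Carrier = Automorphism
  ; _≈_     = _≈Aut_
  ; _∙_     = _∘Aut_
  ; ε       = idAut
  ; _⁻¹     = invAut
  }

-- The dihedral group D₈ of order 8: elements r^a s^b (a ∈ ℤ₄, b ∈ ℤ₂),
-- with s r s⁻¹ = r⁻¹, i.e. (r^a s^b)(r^c s^d) = r^(a + (-1)^b c) s^(b+d).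

_+₄_ : Fin 4 → Fin 4 → Fin 4
a +₄ c = (toℕ a + toℕ c) mod 4

-₄_ : Fin 4 → Fin 4
-₄ a = (4 ∸ toℕ a) mod 4

D8 : Set
D8 = Fin 4 × Bool

_·D_ : D8 → D8 → D8
(a , b) ·D (c , d) = (a +₄ (if b then -₄ c else c)) , (b xor d)

eD : D8
eD = (Data.Fin.zero , false)

invD : D8 → D8
invD (a , false) = (-₄ a , false)
invD (a , true)  = (a , true)

-- (D₈ × D₈) ⋊ C₂, C₂ = Bool acting by swapping the two factors:
-- (x , y , c)(x' , y' , c') = ((x , y) · σ^c (x' , y') , c xor c').

swapIf : Bool → D8 × D8 → D8 × D8
swapIf false p = p
swapIf true (x , y) = (y , x)

W : Set
W = D8 × D8 × Bool

_·W_ : W → W → W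
(x , y , c) ·W (x' , y' , c') with swapIf c (x' , y')
... | (p , q) = (x ·D p) , (y ·D q) , (c xor c')

eW : W
eW = eD , eD , false

invW : W → W
invW (x , y , c) with swapIf c (invD x , invD y)
... | (p , q) = p , q , c

D8xD8⋊C2 : RawGroup 0ℓ 0ℓ
D8xD8⋊C2 = record
  { Carrier = W
  ; _≈_     = _≡_
  ; _∙_     = _·W_
  ; ε       = eW
  ; _⁻¹     = invW
  }

module Submission where

-- A vertex u of AQ₃ is NOT adjacent to u ⊕ 110 and u ⊕ 101 only, so the
-- complement of AQ₃ is two disjoint 4-cycles (even and odd weight vertices),
-- and Aut(AQ₃) is the automorphism group of two 4-cycles.  We number the
-- vertices by cycle coordinates  Pos = Bool × Fin 4  (which cycle, position on
-- it); there adjacency in AQ₃ becomes `far`: different cycles, or opposite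
-- points of one cycle.

open import Defs
open import Data.Product using (∃)
open import Algebra.Morphism.Structures using (module GroupMorphisms)

open import Data.Bool using (Bool; true; false; not; _xor_; _∨_; if_then_else_)
open import Data.Bool.Properties using (¬-not) renaming (_≟_ to _≟B_)
open import Data.Nat using (zero; suc)
open import Data.Fin using (Fin; zero; suc)
open import Data.Fin.Properties using (all?) renaming (_≟_ to _≟F_)
open import Data.Vec using (Vec; []; _∷_; lookup)
open import Data.Vec.Properties using (lookup∘tabulate) renaming (≡-dec to ≡-dec-Vec)
open import Data.Product using (_×_; _,_; proj₁; proj₂)
open import Data.Product.Properties using () renaming (≡-dec to ≡-dec-×)
open import Function.Definitions using (Injective)
open import Relation.Binary.Definitions using (DecidableEquality)
open import Relation.Nullary using (Dec; contradiction)
open import Relation.Nullary.Decidable using (map′; from-yes; ⌊_⌋; _×-dec_; _→-dec_; ¬?)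
open import Relation.Binary.PropositionalEquality
open ≡-Reasoning

pattern f0 = zero
pattern f1 = suc zero
pattern f2 = suc (suc zero)
pattern f3 = suc (suc (suc zero))

Exhaustible : Set → Set₁
Exhaustible A = ∀ {P : A → Set} → (∀ a → Dec (P a)) → Dec (∀ a → P a)

∀-Bool? : Exhaustible Bool
∀-Bool? {P} P? = map′ both (λ h → h true , h false) (P? true ×-dec P? false)
  where
  both : P true × P false → ∀ b → P b
  both (t , _) true  = t
  both (_ , f) false = f

∀-×? : ∀ {A B : Set} → Exhaustible A → Exhaustible B → Exhaustible (A × B)
∀-×? ∀A? ∀B? {P} P? =
  map′ (λ h p → h (proj₁ p) (proj₂ p)) (λ h a b → h (a , b))
       (∀A? λ a → ∀B? λ b → P? (a , b))

∀-Vec? : ∀ {A : Set} → Exhaustible A → ∀ n → Exhaustible (Vec A n)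
∀-Vec? ∀A? zero    P? = map′ (λ { h [] → h }) (λ h → h []) (P? [])
∀-Vec? ∀A? (suc n) P? =
  map′ (λ { h (a ∷ as) → h a as }) (λ h a as → h (a ∷ as))
       (∀A? λ a → ∀-Vec? ∀A? n λ as → P? (a ∷ as))

-- Cycle coordinates of a vertex: which 4-cycle of the complement, and where on it.
Pos : Set
Pos = Bool × Fin 4

∀-Pos? : Exhaustible Pos
∀-Pos? = ∀-×? ∀-Bool? all?

∀-D8? : Exhaustible D8
∀-D8? = ∀-×? all? ∀-Bool?

∀-W? : Exhaustible W
∀-W? = ∀-×? ∀-D8? (∀-×? ∀-D8? ∀-Bool?)

∀-V? : Exhaustible V
∀-V? = ∀-Vec? ∀-Bool? 3

infix 4 _≟P_ _≟D_ _≟W_ _≟V_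

_≟P_ : DecidableEquality Pos
_≟P_ = ≡-dec-× _≟B_ _≟F_

_≟D_ : DecidableEquality D8
_≟D_ = ≡-dec-× _≟F_ _≟B_

_≟W_ : DecidableEquality W
_≟W_ = ≡-dec-× _≟D_ (≡-dec-× _≟D_ _≟B_)

_≟V_ : DecidableEquality V
_≟V_ = ≡-dec-Vec _≟B_

-- pt (k , i) is the i-th vertex of cycle k (k = weight parity); consecutive
-- vertices differ by 110 or 101, the two non-edges at every vertex.
pt : Pos → V
pt (false , f0) = false ∷ false ∷ false ∷ []
pt (false , f1) = true  ∷ true  ∷ false ∷ []
pt (false , f2) = false ∷ true  ∷ true  ∷ []
pt (false , f3) = true  ∷ false ∷ true  ∷ []
pt (true  , f0) = true  ∷ true  ∷ true  ∷ []
pt (true  , f1) = false ∷ false ∷ true  ∷ []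
pt (true  , f2) = true  ∷ false ∷ false ∷ []
pt (true  , f3) = false ∷ true  ∷ false ∷ []

pos : V → Pos
pos (false ∷ false ∷ false ∷ []) = false , f0
pos (true  ∷ true  ∷ false ∷ []) = false , f1
pos (false ∷ true  ∷ true  ∷ []) = false , f2
pos (true  ∷ false ∷ true  ∷ []) = false , f3
pos (true  ∷ true  ∷ true  ∷ []) = true  , f0
pos (false ∷ false ∷ true  ∷ []) = true  , f1
pos (true  ∷ false ∷ false ∷ []) = true  , f2
pos (false ∷ true  ∷ false ∷ []) = true  , f3

pos-pt : ∀ p → pos (pt p) ≡ p
pos-pt = from-yes (∀-Pos? λ p → pos (pt p) ≟P p)

pt-pos : ∀ v → pt (pos v) ≡ v
pt-pos = from-yes (∀-V? λ v → pt (pos v) ≟V v)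

pt-injective : Injective _≡_ _≡_ pt
pt-injective {p} {q} e = trans (sym (pos-pt p)) (trans (cong pos e) (pos-pt q))

pos-injective : Injective _≡_ _≡_ pos
pos-injective {u} {v} e = trans (sym (pt-pos u)) (trans (cong pt e) (pt-pos v))

opposite : Fin 4 → Fin 4 → Bool
opposite i j = ⌊ j ≟F i +₄ f2 ⌋

far : Pos → Pos → Bool
far (k , i) (k' , j) = (k xor k') ∨ opposite i j

adj-pt : ∀ p q → adj (pt p) (pt q) ≡ far p q
adj-pt = from-yes (∀-Pos? λ p → ∀-Pos? λ q → adj (pt p) (pt q) ≟B far p q)

far-false : ∀ p q → far p q ≡ false → proj₁ p ≡ proj₁ q × opposite (proj₂ p) (proj₂ q) ≡ false
far-false = from-yes (∀-Pos? λ p → ∀-Pos? λ q →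
  (far p q ≟B false) →-dec ((proj₁ p ≟B proj₁ q) ×-dec (opposite (proj₂ p) (proj₂ q) ≟B false)))

consecutive-near : ∀ k i → far (k , i) (k , i +₄ f1) ≡ false
consecutive-near k i = from-yes (∀-Pos? λ p → far p (proj₁ p , proj₂ p +₄ f1) ≟B false) (k , i)

dact : D8 → Fin 4 → Fin 4
dact (a , s) i = a +₄ (if s then -₄ i else i)

dact-∙ : ∀ d e i → dact (d ·D e) i ≡ dact d (dact e i)
dact-∙ = from-yes (∀-D8? λ d → ∀-D8? λ e → all? λ i → dact (d ·D e) i ≟F dact d (dact e i))

dact-eD : ∀ i → dact eD i ≡ i
dact-eD = from-yes (all? λ i → dact eD i ≟F i)

dact-invD : ∀ d i → dact d (dact (invD d) i) ≡ i
dact-invD = from-yes (∀-D8? λ d → all? λ i → dact d (dact (invD d) i) ≟F i)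

dact-opposite : ∀ d i j → opposite (dact d i) (dact d j) ≡ opposite i j
dact-opposite = from-yes (∀-D8? λ d → all? λ i → all? λ j →
  opposite (dact d i) (dact d j) ≟B opposite i j)

-- The symmetry of the 4-cycle determined by the images a, b of 0, 1.
readD : Fin 4 → Fin 4 → D8
readD a b = a , not ⌊ b ≟F a +₄ f1 ⌋

readD-dact : ∀ d → readD (dact d f0) (dact d f1) ≡ d
readD-dact = from-yes (∀-D8? λ d → readD (dact d f0) (dact d f1) ≟D d)

walk-is-dihedral : ∀ a b c d → a ≢ b → a ≢ c → b ≢ c → b ≢ d → c ≢ d →
  opposite a b ≡ false → opposite b c ≡ false → opposite c d ≡ false →
  ∀ i → lookup (a ∷ b ∷ c ∷ d ∷ []) i ≡ dact (readD a b) i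
walk-is-dihedral = from-yes (all? λ a → all? λ b → all? λ c → all? λ d →
  ¬? (a ≟F b) →-dec (¬? (a ≟F c) →-dec (¬? (b ≟F c) →-dec (¬? (b ≟F d) →-dec (¬? (c ≟F d) →-dec
  ((opposite a b ≟B false) →-dec ((opposite b c ≟B false) →-dec ((opposite c d ≟B false) →-dec
  all? λ i → lookup (a ∷ b ∷ c ∷ d ∷ []) i ≟F dact (readD a b) i))))))))

cycle-rigid : (σ : Fin 4 → Fin 4) → Injective _≡_ _≡_ σ →
  (∀ i → opposite (σ i) (σ (i +₄ f1)) ≡ false) →
  ∀ i → σ i ≡ dact (readD (σ f0) (σ f1)) i
cycle-rigid σ σ-inj apart i = trans (sym (lookup∘tabulate σ i)) (
  walk-is-dihedral (σ f0) (σ f1) (σ f2) (σ f3)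
    (distinct λ ()) (distinct λ ()) (distinct λ ()) (distinct λ ()) (distinct λ ())
    (apart f0) (apart f1) (apart f2) i)
  where
  distinct : ∀ {i j} → i ≢ j → σ i ≢ σ j
  distinct i≢j e = i≢j (σ-inj e)

act : W → Pos → Pos
act (x , y , c) (k , i) = k xor c , dact (if k xor c then y else x) i

act-∙ : ∀ w w' p → act (w ·W w') p ≡ act w (act w' p)
act-∙ (x , y , false) (x' , y' , false) (false , i) = cong (false ,_) (dact-∙ x x' i)
act-∙ (x , y , false) (x' , y' , false) (true  , i) = cong (true  ,_) (dact-∙ y y' i)
act-∙ (x , y , false) (x' , y' , true)  (false , i) = cong (true  ,_) (dact-∙ y y' i)
act-∙ (x , y , false) (x' , y' , true)  (true  , i) = cong (false ,_) (dact-∙ x x' i)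
act-∙ (x , y , true)  (x' , y' , false) (false , i) = cong (true  ,_) (dact-∙ y x' i)
act-∙ (x , y , true)  (x' , y' , false) (true  , i) = cong (false ,_) (dact-∙ x y' i)
act-∙ (x , y , true)  (x' , y' , true)  (false , i) = cong (false ,_) (dact-∙ x y' i)
act-∙ (x , y , true)  (x' , y' , true)  (true  , i) = cong (true  ,_) (dact-∙ y x' i)

act-eW : ∀ p → act eW p ≡ p
act-eW (false , i) = cong (false ,_) (dact-eD i)
act-eW (true  , i) = cong (true  ,_) (dact-eD i)

invW-inverseˡ : ∀ w → invW w ·W w ≡ eW
invW-inverseˡ = from-yes (∀-W? λ w → invW w ·W w ≟W eW)

invW-inverseʳ : ∀ w → w ·W invW w ≡ eW
invW-inverseʳ = from-yes (∀-W? λ w → w ·W invW w ≟W eW)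

-- W preserves adjacency: it keeps the two cycles apart and moves each by
-- a symmetry of the 4-cycle.
act-far : ∀ w p q → far (act w p) (act w q) ≡ far p q
act-far (x , y , false) (false , i) (false , j) = dact-opposite x i j
act-far (x , y , false) (true  , i) (true  , j) = dact-opposite y i j
act-far (x , y , true)  (false , i) (false , j) = dact-opposite y i j
act-far (x , y , true)  (true  , i) (true  , j) = dact-opposite x i j
act-far (x , y , false) (false , i) (true  , j) = refl
act-far (x , y , false) (true  , i) (false , j) = refl
act-far (x , y , true)  (false , i) (true  , j) = refl
act-far (x , y , true)  (true  , i) (false , j) = refl

wreath : Bool → D8 → D8 → W
wreath false δ₀ δ₁ = δ₀ , δ₁ , false
wreath true  δ₀ δ₁ = δ₁ , δ₀ , true

act-wreath : ∀ c (δ : Bool → D8) k i →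
  act (wreath c (δ false) (δ true)) (k , i) ≡ (k xor c , dact (δ k) i)
act-wreath false δ false i = refl
act-wreath false δ true  i = refl
act-wreath true  δ false i = refl
act-wreath true  δ true  i = refl

readW : (Pos → Pos) → W
readW g = wreath (proj₁ (g (false , f0)))
                 (readD (proj₂ (g (false , f0))) (proj₂ (g (false , f1))))
                 (readD (proj₂ (g (true  , f0))) (proj₂ (g (true  , f1))))

readW-cong : ∀ {g h} → (∀ p → g p ≡ h p) → readW g ≡ readW h
readW-cong e rewrite e (false , f0) | e (false , f1) | e (true , f0) | e (true , f1) = refl

readW-act : ∀ w → readW (act w) ≡ w
readW-act (x , y , false) = cong₂ (λ δ₀ δ₁ → δ₀ , δ₁ , false) (readD-dact x) (readD-dact y)
readW-act (x , y , true)  = cong₂ (λ δ₀ δ₁ → δ₀ , δ₁ , true)  (readD-dact x) (readD-dact y)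

module Rigidity (g : Pos → Pos) (g-inj : Injective _≡_ _≡_ g)
                (g-far : ∀ p q → far (g p) (g q) ≡ far p q) where

  cycle : Bool → Fin 4 → Bool
  cycle k i = proj₁ (g (k , i))

  σ : Bool → Fin 4 → Fin 4
  σ k i = proj₂ (g (k , i))

  δ : Bool → D8
  δ k = readD (σ k f0) (σ k f1)

  neighbours : ∀ k i → cycle k i ≡ cycle k (i +₄ f1) × opposite (σ k i) (σ k (i +₄ f1)) ≡ false
  neighbours k i = far-false (g (k , i)) (g (k , i +₄ f1)) (trans (g-far _ _) (consecutive-near k i))

  cycle-const : ∀ k i → cycle k i ≡ cycle k f0
  cycle-const k f0 = refl
  cycle-const k f1 = sym (proj₁ (neighbours k f0))
  cycle-const k f2 = trans (sym (proj₁ (neighbours k f1))) (sym (proj₁ (neighbours k f0)))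
  cycle-const k f3 = trans (sym (proj₁ (neighbours k f2))) (cycle-const k f2)

  σ-injective : ∀ k → Injective _≡_ _≡_ (σ k)
  σ-injective k {i} {j} e =
    cong proj₂ (g-inj (cong₂ _,_ (trans (cycle-const k i) (sym (cycle-const k j))) e))

  σ-dihedral : ∀ k i → σ k i ≡ dact (δ k) i
  σ-dihedral k = cycle-rigid (σ k) (σ-injective k) (λ i → proj₂ (neighbours k i))

  -- The two cycles go to different cycles: otherwise g (true , 0) would hit
  -- the image of the cycle false, which is the whole target cycle.
  cycles-differ : cycle true f0 ≡ not (cycle false f0)
  cycles-differ = ¬-not same-impossible
    where
    same-impossible : cycle true f0 ≢ cycle false f0
    same-impossible e = contradiction (cong proj₁ (g-inj collision)) λ ()
      where
      j : Fin 4
      j = dact (invD (δ false)) (σ true f0)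
      collision : g (true , f0) ≡ g (false , j)
      collision = cong₂ _,_ (trans e (sym (cycle-const false j))) (begin
        σ true f0                 ≡⟨ sym (dact-invD (δ false) (σ true f0)) ⟩
        dact (δ false) j          ≡⟨ sym (σ-dihedral false j) ⟩
        σ false j                 ∎)

  cycle-label : ∀ k i → cycle k i ≡ k xor cycle false f0
  cycle-label false i = cycle-const false i
  cycle-label true  i = trans (cycle-const true i) cycles-differ

  rigid : ∀ p → g p ≡ act (readW g) p
  rigid (k , i) = begin
    g (k , i)                                 ≡⟨ cong₂ _,_ (cycle-label k i) (σ-dihedral k i) ⟩
    (k xor cycle false f0 , dact (δ k) i)     ≡⟨ sym (act-wreath (cycle false f0) δ k i) ⟩
    act (readW g) (k , i)                     ∎

actV : W → V → V
actV w v = pt (act w (pos v))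

actV-∙ : ∀ w w' v → actV (w ·W w') v ≡ actV w (actV w' v)
actV-∙ w w' v = cong pt (trans (act-∙ w w' (pos v)) (cong (act w) (sym (pos-pt (act w' (pos v))))))

actV-eW : ∀ v → actV eW v ≡ v
actV-eW v = trans (cong pt (act-eW (pos v))) (pt-pos v)

actV-inverse : ∀ w w' → w ·W w' ≡ eW → ∀ v → actV w (actV w' v) ≡ v
actV-inverse w w' e v = begin
  actV w (actV w' v)  ≡⟨ sym (actV-∙ w w' v) ⟩
  actV (w ·W w') v    ≡⟨ cong (λ u → actV u v) e ⟩
  actV eW v           ≡⟨ actV-eW v ⟩
  v                   ∎

actV-adj : ∀ w u v → adj (actV w u) (actV w v) ≡ adj u v
actV-adj w u v = begin
  adj (actV w u) (actV w v)          ≡⟨ adj-pt _ _ ⟩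
  far (act w (pos u)) (act w (pos v)) ≡⟨ act-far w (pos u) (pos v) ⟩
  far (pos u) (pos v)                 ≡⟨ sym (adj-pt _ _) ⟩
  adj (pt (pos u)) (pt (pos v))       ≡⟨ cong₂ adj (pt-pos u) (pt-pos v) ⟩
  adj u v                             ∎

autOf : W → Automorphism
autOf w = record
  { fun   = actV w
  ; inv   = actV (invW w)
  ; inv-l = actV-inverse (invW w) w (invW-inverseˡ w)
  ; inv-r = actV-inverse w (invW w) (invW-inverseʳ w)
  ; pres  = actV-adj w
  }

coords : Automorphism → Pos → Pos
coords f p = pos (fun f (pt p))

coords-injective : ∀ f → Injective _≡_ _≡_ (coords f)
coords-injective f e = pt-injective (fun-injective (pos-injective e))
  where
  fun-injective : Injective _≡_ _≡_ (fun f)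
  fun-injective {u} {v} e = trans (sym (inv-l f u)) (trans (cong (inv f) e) (inv-l f v))

coords-far : ∀ f p q → far (coords f p) (coords f q) ≡ far p q
coords-far f p q = begin
  far (coords f p) (coords f q)                        ≡⟨ sym (adj-pt _ _) ⟩
  adj (pt (coords f p)) (pt (coords f q))              ≡⟨ cong₂ adj (pt-pos _) (pt-pos _) ⟩
  adj (fun f (pt p)) (fun f (pt q))                    ≡⟨ pres f (pt p) (pt q) ⟩
  adj (pt p) (pt q)                                    ≡⟨ adj-pt p q ⟩
  far p q                                              ∎

φ : Automorphism → W
φ f = readW (coords f)

rigidity : ∀ f v → fun f v ≡ actV (φ f) v
rigidity f v = begin
  fun f v                    ≡⟨ sym (pt-pos _) ⟩
  pt (pos (fun f v))         ≡⟨ cong (λ u → pt (pos (fun f u))) (sym (pt-pos v)) ⟩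
  pt (coords f (pos v))      ≡⟨ cong pt (Rigidity.rigid (coords f) (coords-injective f) (coords-far f) (pos v)) ⟩
  actV (φ f) v               ∎

φ-of : ∀ f w → (∀ v → fun f v ≡ actV w v) → φ f ≡ w
φ-of f w e = trans (readW-cong coords≡act) (readW-act w)
  where
  coords≡act : ∀ p → coords f p ≡ act w p
  coords≡act p = trans (cong pos (e (pt p))) (trans (pos-pt _) (cong (act w) (pos-pt p)))

φ-cong : ∀ {f g} → f ≈Aut g → φ f ≡ φ g
φ-cong {f} {g} f≈g = φ-of f (φ g) λ v → trans (f≈g v) (rigidity g v)

φ-∘ : ∀ f g → φ (f ∘Aut g) ≡ φ f ·W φ g
φ-∘ f g = φ-of (f ∘Aut g) (φ f ·W φ g) λ v → begin
  fun f (fun g v)                 ≡⟨ cong (fun f) (rigidity g v) ⟩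
  fun f (actV (φ g) v)            ≡⟨ rigidity f _ ⟩
  actV (φ f) (actV (φ g) v)       ≡⟨ sym (actV-∙ (φ f) (φ g) v) ⟩
  actV (φ f ·W φ g) v             ∎

φ-id : φ idAut ≡ eW
φ-id = φ-of idAut eW λ v → sym (actV-eW v)

φ-inv : ∀ f → φ (invAut f) ≡ invW (φ f)
φ-inv f = φ-of (invAut f) (invW (φ f)) λ v → begin
  inv f v                                 ≡⟨ sym (actV-inverse (invW (φ f)) (φ f) (invW-inverseˡ (φ f)) (inv f v)) ⟩
  actV (invW (φ f)) (actV (φ f) (inv f v)) ≡⟨ cong (actV (invW (φ f))) (sym (rigidity f (inv f v))) ⟩
  actV (invW (φ f)) (fun f (inv f v))      ≡⟨ cong (actV (invW (φ f))) (inv-r f v) ⟩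
  actV (invW (φ f)) v                      ∎

φ-injective : ∀ {f g} → φ f ≡ φ g → f ≈Aut g
φ-injective {f} {g} e v = begin
  fun f v           ≡⟨ rigidity f v ⟩
  actV (φ f) v      ≡⟨ cong (λ w → actV w v) e ⟩
  actV (φ g) v      ≡⟨ sym (rigidity g v) ⟩
  fun g v           ∎

φ-surjective : ∀ w → ∃ λ f → ∀ {f'} → f' ≈Aut f → φ f' ≡ w
φ-surjective w = autOf w , λ {f'} f'≈ → φ-of f' w f'≈

mainTheorem3 : ∃ λ φ → GroupMorphisms.IsGroupIsomorphism AutAQ3 D8xD8⋊C2 φ
mainTheorem3 = φ , record
  { isGroupMonomorphism = record
    { isGroupHomomorphism = record
      { isMonoidHomomorphism = record
        { isMagmaHomomorphism = record
          { isRelHomomorphism = record { cong = λ {f} {g} → φ-cong {f} {g} }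
          ; homo = φ-∘
          }
        ; ε-homo = φ-id
        }
      ; ⁻¹-homo = φ-inv
      }
    ; injective = λ {f} {g} → φ-injective {f} {g}
    }
  ; surjective = φ-surjective
  }
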